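{- There is a non-adaptive deterministic group testing algorithm on $n$ items that makes $t=\log n+0.5\log\log n+O(1)$ tests and, for every defective set $I\subseteq[n]$, decides whether $|I|\le 1$, and if $|I|=1$ outputs the unique defective item.
   Context: Group testing model: the items are $[n]=\{1,\dots,n\}$ and there is an unknown set $I\subseteq[n]$ of defective items. A test is a subset $Q\subseteq[n]$, and its answer is $T_I(Q)=1$ if $Q\cap I\neq\emptyset$ and $0$ otherwise. A non-adaptive algorithm fixes all its tests before seeing any answer. Logarithms are base 2. -}

module Defs where

open import Data.Nat using (ℕ; _≥_; _≤_; _*_; _^_)
open import Data.Nat.Logarithm using (⌊log₂_⌋)
open import Data.Bool using (Bool)
open import Data.Maybe using (Maybe; just)
open import Data.Fin using (Fin)
open import Data.Fin.Subset using (Subset; _∩_; ∣_∣; ⁅_⁆)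
open import Data.Fin.Subset.Properties using (nonempty?)
open import Data.Product using (∃; Σ; _×_)
open import Relation.Nullary using (does)
open import Relation.Binary.PropositionalEquality using (_≡_)

T : ∀ {n} → Subset n → Subset n → Bool
T I Q = does (nonempty? (Q ∩ I))

-- Output of the decoder: either "|I| ≥ 2", or "|I| ≤ 1" together with
-- an optional item (which must be the defective item when |I| = 1).
data Verdict (n : ℕ) : Set where
  atLeastTwo : Verdict n
  atMostOne  : Maybe (Fin n) → Verdict n

record NonAdaptive (n t : ℕ) : Set where
  field
    tests  : Fin t → Subset n
    decode : (Fin t → Bool) → Verdict n

  run : Subset n → Verdict n
  run I = decode (λ j → T I (tests j))

Correct : ∀ {n t} → NonAdaptive n t → Set
Correct {n} A =
  (∀ (I : Subset n) → ∣ I ∣ ≥ 2 → NonAdaptive.run A I ≡ atLeastTwo)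
  × (∀ (I : Subset n) → ∣ I ∣ ≤ 1 → ∃ λ m → NonAdaptive.run A I ≡ atMostOne m)
  × (∀ (i : Fin n) → NonAdaptive.run A ⁅ i ⁆ ≡ atMostOne (just i))

-- Give each item its own w-element set of the t = 2w tests, which is possible once n ≤ C(2w, w).
-- Sets of equal size form an antichain, so the union of the codes of two or more defectives is never
-- a code: the decoder reports the item whose code is the answer vector, "none" if the answer is
-- empty, and "at least two" otherwise. For the least such w we have C(2w−2, w−1) < n, and
-- C(2k, k)² ≥ 16^k / (4k+1) then gives 4^t = 16^w ≤ 80 n² log n.
module Submission where

open import Defs
open import Data.Nat
open import Data.Nat.Properties
open import Data.Nat.Logarithm using (⌊log₂_⌋; ⌊log₂⌋-mono-≤; ⌊log₂[2^n]⌋≡n)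
open import Data.Nat.Combinatorics using (_C_; nC1≡n; nCk≡nC[n∸k]; nCk+nC[k+1]≡[n+1]C[k+1])
open import Data.Nat.Tactic.RingSolver using (solve-∀)
open import Data.Bool using (Bool; true)
import Data.Bool.Properties as Bool
open import Data.Maybe using (just; nothing)
open import Data.Fin using (Fin; zero; suc; toℕ)
import Data.Fin.Properties as Fin
open import Data.Fin.Subset
open import Data.Fin.Subset.Properties
open import Data.Vec using ([]; _∷_; lookup; tabulate; here; there)
open import Data.Vec.Properties using (lookup∘tabulate; []=⇒lookup; lookup⇒[]=; ≡-dec)
open import Data.Product using (∃; ∃₂; Σ; _,_; _×_)
open import Data.Sum using (inj₁; inj₂)
open import Function using (_∘_)
open import Relation.Nullary using (Dec; yes; no; ¬_; contradiction)
open import Relation.Nullary.Decidable using (dec-true)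
open import Relation.Binary.PropositionalEquality

C-absorption : ∀ n k → suc k * (suc n C suc k) ≡ suc n * (n C k)
C-absorption n       zero    = trans (*-identityˡ _) (trans (nC1≡n (suc n)) (sym (*-identityʳ _)))
C-absorption zero    (suc k) = *-zeroʳ (suc (suc k))
C-absorption (suc n) (suc k) = begin
  suc (suc k) * (suc (suc n) C suc (suc k))
    ≡⟨ cong (suc (suc k) *_) (nCk+nC[k+1]≡[n+1]C[k+1] (suc n) (suc k)) ⟨
  suc (suc k) * (A + B)                        ≡⟨ distrib k A B ⟩
  A + suc k * A + suc (suc k) * B
    ≡⟨ cong₂ (λ a b → A + a + b) (C-absorption n k) (C-absorption n (suc k)) ⟩
  A + suc n * (n C k) + suc n * (n C suc k)    ≡⟨ +-assoc A _ _ ⟩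
  A + (suc n * (n C k) + suc n * (n C suc k))  ≡⟨ cong (A +_) (*-distribˡ-+ (suc n) (n C k) (n C suc k)) ⟨
  A + suc n * (n C k + n C suc k)              ≡⟨ cong (λ c → A + suc n * c) (nCk+nC[k+1]≡[n+1]C[k+1] n k) ⟩
  suc (suc n) * A                              ∎
  where
  open ≡-Reasoning
  A B : ℕ
  A = suc n C suc k
  B = suc n C suc (suc k)
  distrib : ∀ a x y → suc (suc a) * (x + y) ≡ x + suc a * x + suc (suc a) * y
  distrib = solve-∀

centralBinomial : ℕ → ℕ
centralBinomial k = (k + k) C k

centralBinomial-suc : ∀ k → suc k * centralBinomial (suc k) ≡ 2 * suc (k + k) * centralBinomial k
centralBinomial-suc k = begin
  suc k * ((suc k + suc k) C suc k)      ≡⟨ cong (λ m → suc k * (suc m C suc k)) (+-suc k k) ⟩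
  suc k * (suc (suc (k + k)) C suc k)    ≡⟨ C-absorption (suc (k + k)) k ⟩
  suc (suc (k + k)) * (suc (k + k) C k)  ≡⟨ cong (suc (suc (k + k)) *_) symmetry ⟩
  suc (suc (k + k)) * (suc (k + k) C suc k) ≡⟨ regroup k (suc (k + k) C suc k) ⟩
  2 * (suc k * (suc (k + k) C suc k))    ≡⟨ cong (2 *_) (C-absorption (k + k) k) ⟩
  2 * (suc (k + k) * centralBinomial k)  ≡⟨ *-assoc 2 (suc (k + k)) (centralBinomial k) ⟨
  2 * suc (k + k) * centralBinomial k    ∎
  where
  open ≡-Reasoning
  symmetry : suc (k + k) C k ≡ suc (k + k) C suc k
  symmetry = trans (nCk≡nC[n∸k] (m≤n⇒m≤1+n (m≤m+n k k)))
                   (cong (suc (k + k) C_) (trans (+-∸-assoc 1 (m≤m+n k k)) (cong suc (m+n∸m≡n k k))))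
  regroup : ∀ k x → suc (suc (k + k)) * x ≡ 2 * (suc k * x)
  regroup = solve-∀

2*centralBinomial≤centralBinomial-suc : ∀ k → 2 * centralBinomial k ≤ centralBinomial (suc k)
2*centralBinomial≤centralBinomial-suc k = *-cancelˡ-≤ (suc k) (begin
  suc k * (2 * centralBinomial k)      ≡⟨ x∙yz≈y∙xz (suc k) 2 (centralBinomial k) ⟩
  2 * (suc k * centralBinomial k)      ≡⟨ *-assoc 2 (suc k) _ ⟨
  2 * suc k * centralBinomial k        ≤⟨ *-monoˡ-≤ (centralBinomial k) (*-monoʳ-≤ 2 (s≤s (m≤m+n k k))) ⟩
  2 * suc (k + k) * centralBinomial k  ≡⟨ centralBinomial-suc k ⟨
  suc k * centralBinomial (suc k)      ∎)
  where
  open ≤-Reasoning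
  open import Algebra.Properties.CommutativeSemigroup *-commutativeSemigroup using (x∙yz≈y∙xz)

2^k≤centralBinomial : ∀ k → 2 ^ k ≤ centralBinomial k
2^k≤centralBinomial zero    = ≤-refl
2^k≤centralBinomial (suc k) =
  ≤-trans (*-monoʳ-≤ 2 (2^k≤centralBinomial k)) (2*centralBinomial≤centralBinomial-suc k)

centralBinomial-< : ∀ k → centralBinomial k < centralBinomial (suc k)
centralBinomial-< k = begin-strict
  centralBinomial k
    <⟨ m<m+n (centralBinomial k) (≤-trans (m^n>0 2 k) (2^k≤centralBinomial k)) ⟩
  centralBinomial k + centralBinomial k      ≡⟨ cong (centralBinomial k +_) (+-identityʳ _) ⟨
  2 * centralBinomial k                      ≤⟨ 2*centralBinomial≤centralBinomial-suc k ⟩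
  centralBinomial (suc k)                    ∎
  where open ≤-Reasoning

16^k≤[4k+1]*centralBinomial² : ∀ k → 16 ^ k ≤ (4 * k + 1) * (centralBinomial k * centralBinomial k)
16^k≤[4k+1]*centralBinomial² zero    = ≤-refl
16^k≤[4k+1]*centralBinomial² (suc k) = *-cancelˡ-≤ (suc k * suc k) (begin
  suc k * suc k * 16 ^ suc k                              ≡⟨ shift (suc k) (16 ^ k) ⟩
  16 * (suc k * suc k) * 16 ^ k
    ≤⟨ *-monoʳ-≤ (16 * (suc k * suc k)) (16^k≤[4k+1]*centralBinomial² k) ⟩
  16 * (suc k * suc k) * ((4 * k + 1) * (c * c))          ≡⟨ *-assoc (16 * (suc k * suc k)) (4 * k + 1) (c * c) ⟨
  16 * (suc k * suc k) * (4 * k + 1) * (c * c)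
    ≤⟨ *-monoˡ-≤ (c * c) (m≤n+m (16 * (suc k * suc k) * (4 * k + 1)) 4) ⟩
  (4 + 16 * (suc k * suc k) * (4 * k + 1)) * (c * c)      ≡⟨ cong (_* (c * c)) (cubic k) ⟩
  (4 * suc k + 1) * (4 * (suc (k + k) * suc (k + k))) * (c * c)
    ≡⟨ square (4 * suc k + 1) (suc (k + k)) c ⟩
  (4 * suc k + 1) * ((2 * suc (k + k) * c) * (2 * suc (k + k) * c))
    ≡⟨ cong (λ x → (4 * suc k + 1) * (x * x)) (centralBinomial-suc k) ⟨
  (4 * suc k + 1) * ((suc k * c′) * (suc k * c′))          ≡⟨ square′ (4 * suc k + 1) (suc k) c′ ⟩
  suc k * suc k * ((4 * suc k + 1) * (c′ * c′))            ∎)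
  where
  open ≤-Reasoning
  c c′ : ℕ
  c  = centralBinomial k
  c′ = centralBinomial (suc k)
  shift : ∀ s x → s * s * (16 * x) ≡ 16 * (s * s) * x
  shift = solve-∀
  -- the slack 4 makes the needed inequality an identity of polynomials
  cubic : ∀ k → 4 + 16 * (suc k * suc k) * (4 * k + 1) ≡ (4 * suc k + 1) * (4 * (suc (k + k) * suc (k + k)))
  cubic = solve-∀
  square : ∀ a d c → a * (4 * (d * d)) * (c * c) ≡ a * ((2 * d * c) * (2 * d * c))
  square = solve-∀
  square′ : ∀ a s c → a * ((s * c) * (s * c)) ≡ s * s * (a * (c * c))
  square′ = solve-∀

crossing-point : (f : ℕ → ℕ) → (∀ k → f k < f (suc k)) →
                 ∀ {n} → f 0 < n → ∃ λ k → f k < n × n ≤ f (suc k)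
crossing-point f f-< {suc n} (s≤s f0≤n) with m≤n⇒m<n∨m≡n f0≤n
... | inj₂ refl  = 0 , ≤-refl , f-< 0
... | inj₁ f0<n with crossing-point f f-< f0<n
...   | k , fk<n , n≤fk+1 with m≤n⇒m<n∨m≡n n≤fk+1
...     | inj₁ n<fk+1 = k , m<n⇒m<1+n fk<n , n<fk+1
...     | inj₂ refl   = suc k , ≤-refl , f-< (suc k)

p⊆q∧∣p∣≡∣q∣⇒p≡q : ∀ {n} {p q : Subset n} → p ⊆ q → ∣ p ∣ ≡ ∣ q ∣ → p ≡ q
p⊆q∧∣p∣≡∣q∣⇒p≡q {p = []}          {[]}          _   _ = refl
p⊆q∧∣p∣≡∣q∣⇒p≡q {p = inside  ∷ p} {inside  ∷ q} p⊆q e =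
  cong (inside ∷_) (p⊆q∧∣p∣≡∣q∣⇒p≡q (drop-∷-⊆ p⊆q) (suc-injective e))
p⊆q∧∣p∣≡∣q∣⇒p≡q {p = inside  ∷ p} {outside ∷ q} p⊆q e with p⊆q here
... | ()
p⊆q∧∣p∣≡∣q∣⇒p≡q {p = outside ∷ p} {inside  ∷ q} p⊆q e =
  contradiction (p⊆q⇒∣p∣≤∣q∣ (drop-∷-⊆ p⊆q)) (<⇒≱ (≤-reflexive (sym e)))
p⊆q∧∣p∣≡∣q∣⇒p≡q {p = outside ∷ p} {outside ∷ q} p⊆q e =
  cong (outside ∷_) (p⊆q∧∣p∣≡∣q∣⇒p≡q (drop-∷-⊆ p⊆q) e)

x∈p⇒1≤∣p∣ : ∀ {n} {x : Fin n} {p} → x ∈ p → 1 ≤ ∣ p ∣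
x∈p⇒1≤∣p∣ {x = x} {p} x∈p = ≤-trans (≤-reflexive (sym (∣⁅x⁆∣≡1 x)))
  (p⊆q⇒∣p∣≤∣q∣ λ y∈⁅x⁆ → subst (_∈ p) (sym (x∈⁅y⁆⇒x≡y x y∈⁅x⁆)) x∈p)

x∈p∧y∈p∧x≢y⇒2≤∣p∣ : ∀ {n} {x y : Fin n} {p} → x ∈ p → y ∈ p → x ≢ y → 2 ≤ ∣ p ∣
x∈p∧y∈p∧x≢y⇒2≤∣p∣ x∈p y∈p x≢y =
  <-≤-trans (s≤s (x∈p⇒1≤∣p∣ (x∈p∧x≢y⇒x∈p-y y∈p (x≢y ∘ sym)))) (x∈p⇒∣p-x∣<∣p∣ x∈p)

1≤∣p∣⇒Nonempty : ∀ {n} {p : Subset n} → 1 ≤ ∣ p ∣ → Nonempty p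
1≤∣p∣⇒Nonempty {n} {p} 1≤∣p∣ with nonempty? p
... | yes ne = ne
... | no  ∅  = contradiction (subst (1 ≤_) ∣p∣≡0 1≤∣p∣) λ ()
  where
  ∣p∣≡0 : ∣ p ∣ ≡ 0
  ∣p∣≡0 = trans (cong ∣_∣ (Empty-unique ∅)) (∣⊥∣≡0 n)

2≤∣p∣⇒distinct : ∀ {n} {p : Subset n} → 2 ≤ ∣ p ∣ → ∃₂ λ x y → x ≢ y × x ∈ p × y ∈ p
2≤∣p∣⇒distinct {p = inside ∷ p} (s≤s 1≤∣p∣) =
  let y , y∈p = 1≤∣p∣⇒Nonempty 1≤∣p∣ in zero , suc y , (λ ()) , here , there y∈p
2≤∣p∣⇒distinct {p = outside ∷ p} 2≤∣p∣ =
  let x , y , x≢y , x∈p , y∈p = 2≤∣p∣⇒distinct 2≤∣p∣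
  in suc x , suc y , x≢y ∘ Fin.suc-injective , there x∈p , there y∈p

∈-tabulate⁺ : ∀ {n} {f : Fin n → Bool} {x} → f x ≡ true → x ∈ tabulate f
∈-tabulate⁺ {f = f} {x} fx = lookup⇒[]= x (tabulate f) (trans (lookup∘tabulate f x) fx)

∈-tabulate⁻ : ∀ {n} {f : Fin n → Bool} {x} → x ∈ tabulate f → f x ≡ true
∈-tabulate⁻ {f = f} {x} x∈ = trans (sym (lookup∘tabulate f x)) ([]=⇒lookup x∈)

T-sound : ∀ {n} {I Q : Subset n} → T I Q ≡ true → Nonempty (Q ∩ I)
T-sound {I = I} {Q} _ with nonempty? (Q ∩ I)
T-sound _  | yes ne = ne
T-sound () | no  _

T-complete : ∀ {n} {I Q : Subset n} → Nonempty (Q ∩ I) → T I Q ≡ true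
T-complete {I = I} {Q} = dec-true (nonempty? (Q ∩ I))

module AntichainDesign {n t} (code : Fin n → Subset t)
                       (antichain : ∀ {i r} → code i ⊆ code r → i ≡ r) where

  tests : Fin t → Subset n
  tests j = tabulate λ i → lookup (code i) j

  answer : Subset n → Subset t
  answer I = tabulate λ j → T I (tests j)

  isCode? : ∀ v → Dec (∃ λ i → code i ≡ v)
  isCode? v = Fin.any? λ i → ≡-dec Bool._≟_ (code i) v

  decodeAnswer : Subset t → Verdict n
  decodeAnswer v with isCode? v
  ... | yes (i , _) = atMostOne (just i)
  ... | no  _ with nonempty? v
  ...   | yes _ = atLeastTwo
  ...   | no  _ = atMostOne nothing

  design : NonAdaptive n t
  design = record { tests = tests ; decode = decodeAnswer ∘ tabulate }

  code-⊆-answer : ∀ {i I} → i ∈ I → code i ⊆ answer I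
  code-⊆-answer i∈I j∈code =
    ∈-tabulate⁺ (T-complete (_ , x∈p∩q⁺ (∈-tabulate⁺ ([]=⇒lookup j∈code) , i∈I)))

  answer-⊆-codes : ∀ {j I} → j ∈ answer I → ∃ λ i → i ∈ I × j ∈ code i
  answer-⊆-codes {j} j∈answer =
    let i , i∈tests∩I = T-sound (∈-tabulate⁻ j∈answer)
        i∈tests , i∈I = x∈p∩q⁻ _ _ i∈tests∩I
    in i , i∈I , lookup⇒[]= j (code i) (∈-tabulate⁻ i∈tests)

  answer-unique : ∀ {i I} → i ∈ I → (∀ {r} → r ∈ I → r ≡ i) → answer I ≡ code i
  answer-unique i∈I unique = ⊆-antisym
    (λ j∈answer → let r , r∈I , j∈code = answer-⊆-codes j∈answer in
                  subst (λ s → _ ∈ code s) (unique r∈I) j∈code)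
    (code-⊆-answer i∈I)

  answer≡code⇒member≡ : ∀ {r s I} → r ∈ I → answer I ≡ code s → r ≡ s
  answer≡code⇒member≡ r∈I e = antichain λ j∈ → subst (_ ∈_) e (code-⊆-answer r∈I j∈)

  answer-Empty : ∀ {I} → Empty I → Empty (answer I)
  answer-Empty ∅ (_ , j∈answer) = let i , i∈I , _ = answer-⊆-codes j∈answer in ∅ (i , i∈I)

  code-Nonempty : ∀ {i r} → i ≢ r → Nonempty (code i)
  code-Nonempty {i} {r} i≢r with nonempty? (code i)
  ... | yes ne = ne
  ... | no  ∅  = contradiction (antichain λ j∈ → contradiction (_ , j∈) ∅) i≢r

  decode-code : ∀ i → decodeAnswer (code i) ≡ atMostOne (just i)
  decode-code i with isCode? (code i)
  ... | yes (r , e) = cong (atMostOne ∘ just) (antichain (⊆-reflexive e))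
  ... | no  ¬code   = contradiction (i , refl) ¬code

  decode-Empty : ∀ {v} → Empty v → ∃ λ m → decodeAnswer v ≡ atMostOne m
  decode-Empty {v} ∅ with isCode? v
  ... | yes (i , _) = just i , refl
  ... | no  _ with nonempty? v
  ...   | yes ne = contradiction ne ∅
  ...   | no  _  = nothing , refl

  decode-nonCode : ∀ {v} → (∀ i → code i ≢ v) → Nonempty v → decodeAnswer v ≡ atLeastTwo
  decode-nonCode {v} ¬code ne with isCode? v
  ... | yes (i , e) = contradiction e (¬code i)
  ... | no  _ with nonempty? v
  ...   | yes _ = refl
  ...   | no  ∅ = contradiction ne ∅

  design-correct : Correct design
  design-correct = atLeastTwo-correct , atMostOne-correct , singleton-correct
    where
    atLeastTwo-correct : ∀ I → ∣ I ∣ ≥ 2 → decodeAnswer (answer I) ≡ atLeastTwo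
    atLeastTwo-correct I 2≤∣I∣ with 2≤∣p∣⇒distinct 2≤∣I∣
    ... | x , y , x≢y , x∈I , y∈I =
      let j , j∈code = code-Nonempty x≢y in
      decode-nonCode
        (λ s e → x≢y (trans (answer≡code⇒member≡ x∈I (sym e)) (sym (answer≡code⇒member≡ y∈I (sym e)))))
        (j , code-⊆-answer x∈I j∈code)
    atMostOne-correct : ∀ I → ∣ I ∣ ≤ 1 → ∃ λ m → decodeAnswer (answer I) ≡ atMostOne m
    atMostOne-correct I ∣I∣≤1 with nonempty? I
    ... | no  ∅         = decode-Empty (answer-Empty ∅)
    ... | yes (i , i∈I) = just i , trans (cong decodeAnswer (answer-unique i∈I unique)) (decode-code i)
      where
      unique : ∀ {r} → r ∈ I → r ≡ i
      unique {r} r∈I with r Fin.≟ i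
      ... | yes r≡i = r≡i
      ... | no  r≢i = contradiction ∣I∣≤1 (<⇒≱ (x∈p∧y∈p∧x≢y⇒2≤∣p∣ r∈I i∈I r≢i))
    singleton-correct : ∀ i → decodeAnswer (answer ⁅ i ⁆) ≡ atMostOne (just i)
    singleton-correct i = trans (cong decodeAnswer (answer-unique (x∈⁅x⁆ i) (x∈⁅y⁆⇒x≡y i))) (decode-code i)

-- for x < t C w, the x-th w-element subset of Fin t, those containing 0 listed first
unrank : (t w : ℕ) → ℕ → Subset t
unrank t       zero    x = ⊥
unrank zero    (suc w) x = []
unrank (suc t) (suc w) x with x <? t C w
... | yes _ = inside  ∷ unrank t w x
... | no  _ = outside ∷ unrank t (suc w) (x ∸ t C w)

rank : ∀ {t} → ℕ → Subset t → ℕ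
rank         zero    p             = 0
rank         (suc w) []            = 0
rank {suc t} (suc w) (inside  ∷ p) = rank w p
rank {suc t} (suc w) (outside ∷ p) = t C w + rank (suc w) p

∸-<-pascal : ∀ t w {x} → ¬ x < t C w → x < suc t C suc w → x ∸ t C w < t C suc w
∸-<-pascal t w {x} x≮ x< = +-cancelˡ-< (t C w) _ _ (begin-strict
  t C w + (x ∸ t C w)  ≡⟨ m+[n∸m]≡n (≮⇒≥ x≮) ⟩
  x                    <⟨ x< ⟩
  suc t C suc w        ≡⟨ nCk+nC[k+1]≡[n+1]C[k+1] t w ⟨
  t C w + t C suc w    ∎)
  where open ≤-Reasoning

∣unrank∣ : ∀ t w {x} → x < t C w → ∣ unrank t w x ∣ ≡ w
∣unrank∣ t       zero    _ = ∣⊥∣≡0 t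
∣unrank∣ (suc t) (suc w) {x} x< with x <? t C w
... | yes x<′ = cong suc (∣unrank∣ t w x<′)
... | no  x≮  = ∣unrank∣ t (suc w) (∸-<-pascal t w x≮ x<)

rank∘unrank : ∀ t w {x} → x < t C w → rank w (unrank t w x) ≡ x
rank∘unrank t       zero    (s≤s z≤n) = refl
rank∘unrank (suc t) (suc w) {x} x< with x <? t C w
... | yes x<′ = rank∘unrank t w x<′
... | no  x≮  =
  trans (cong (t C w +_) (rank∘unrank t (suc w) (∸-<-pascal t w x≮ x<))) (m+[n∸m]≡n (≮⇒≥ x≮))

unrank-injective : ∀ t w {x y} → x < t C w → y < t C w → unrank t w x ≡ unrank t w y → x ≡ y
unrank-injective t w {x} {y} x< y< e =
  trans (sym (rank∘unrank t w x<)) (trans (cong (rank w) e) (rank∘unrank t w y<))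

weightCode : ∀ {n} t w → Fin n → Subset t
weightCode t w i = unrank t w (toℕ i)

weightCode-antichain : ∀ {n} t w → n ≤ t C w →
                       ∀ {i r : Fin n} → weightCode t w i ⊆ weightCode t w r → i ≡ r
weightCode-antichain t w n≤tCw {i} {r} code-i⊆code-r =
  Fin.toℕ-injective (unrank-injective t w (index< i) (index< r) (p⊆q∧∣p∣≡∣q∣⇒p≡q code-i⊆code-r sameWeight))
  where
  index< : ∀ j → toℕ j < t C w
  index< j = <-≤-trans (Fin.toℕ<n j) n≤tCw
  sameWeight : ∣ weightCode t w i ∣ ≡ ∣ weightCode t w r ∣
  sameWeight = trans (∣unrank∣ t w (index< i)) (sym (∣unrank∣ t w (index< r)))

4^[m+m]≡16^m : ∀ m → 4 ^ (m + m) ≡ 16 ^ m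
4^[m+m]≡16^m m = sym (trans (^-*-assoc 4 2 m) (cong (λ e → 4 ^ (m + e)) (+-identityʳ m)))

testCount-bound : ∀ {n} k → 2 ≤ n → centralBinomial k < n →
                  4 ^ (suc k + suc k) ≤ 80 * (n * n) * ⌊log₂ n ⌋
testCount-bound {n} k 2≤n c<n = begin
  4 ^ (suc k + suc k)           ≡⟨ 4^[m+m]≡16^m (suc k) ⟩
  16 * 16 ^ k                   ≤⟨ *-monoʳ-≤ 16 (16^k≤[4k+1]*centralBinomial² k) ⟩
  16 * ((4 * k + 1) * (c * c))
    ≤⟨ *-monoʳ-≤ 16 (*-mono-≤ (+-mono-≤ (*-monoʳ-≤ 4 k≤L) 1≤L) (*-mono-≤ c≤n c≤n)) ⟩
  16 * ((4 * L + L) * (n * n))  ≡⟨ regroup L (n * n) ⟩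
  80 * (n * n) * L              ∎
  where
  open ≤-Reasoning
  c L : ℕ
  c = centralBinomial k
  L = ⌊log₂ n ⌋
  c≤n : c ≤ n
  c≤n = <⇒≤ c<n
  k≤L : k ≤ L
  k≤L = subst (_≤ L) (⌊log₂[2^n]⌋≡n k) (⌊log₂⌋-mono-≤ (≤-trans (2^k≤centralBinomial k) c≤n))
  1≤L : 1 ≤ L
  1≤L = ⌊log₂⌋-mono-≤ 2≤n
  regroup : ∀ L x → 16 * ((4 * L + L) * x) ≡ 80 * x * L
  regroup = solve-∀

lemma9 : ∃ λ (K : ℕ) → ∀ (n : ℕ) → n ≥ 2 →
           Σ ℕ λ t → (4 ^ t ≤ K * (n * n) * ⌊log₂ n ⌋)
             × Σ (NonAdaptive n t) Correct
lemma9 = 80 , λ n 2≤n →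
  let k , c<n , n≤c = crossing-point centralBinomial centralBinomial-< 2≤n
      t : ℕ
      t = suc k + suc k
      open AntichainDesign (weightCode t (suc k)) (weightCode-antichain t (suc k) n≤c)
  in t , testCount-bound k 2≤n c<n , design , design-correct
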